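{- For every domain $D$ there is an LTL formula over $E\cup A$ equivalent to $\omega_D$ (i.e., satisfied by exactly the traces in $\omega_D$), and the size of this LTL formula is linear in the size of $D$.
   Context: A domain is $D=(E,A,I,Pre,\Delta)$ where $E$ (fluents) and $A$ (action variables) are disjoint non-empty finite sets of Boolean variables, $\mathcal{E}=2^E$, $\mathcal{A}=2^A$, $I\subseteq\mathcal{E}$ is non-empty, $Pre\subseteq\mathcal{E}\times\mathcal{A}$ is such that every $s\in\mathcal{E}$ has some $a$ with $(s,a)\in Pre$ ($a$ is available in $s$), and $\Delta\subseteq\mathcal{E}\times\mathcal{A}\times\mathcal{E}$ with $(s,a,t)\in\Delta$ implying $(s,a)\in Pre$. Domains are given compactly by $(E,A,init,pre,\delta)$ with $init$ a Boolean formula over $E$, $pre$ a Boolean formula over $E\cup A$, $\delta$ a Boolean formula over $E\cup A\cup E'$ where $E'=\{e':e\in E\}$, inducing $s\in I$ iff $s\models init$, $(s,a)\in Pre$ iff $s\cup a\models pre$, $(s,a,t)\in\Delta$ iff $s\cup a\cup\{e':e\in t\}\models\delta$. The size of $D$ is $|E|+|A|+|init|+|pre|+|\delta|$. A trace is an infinite sequence $\pi_0\pi_1\cdots$ of subsets of $E\cup A$. $\omega_D$ is the set of traces $\pi$ such that (1) $\pi_0\cap E\in I$ and (2) for all $n\ge1$, if $\pi_i\cap A$ is available in $\pi_i\cap E$ for every $i\in[0,n-1]$, then $(\pi_{n-1}\cap E,\pi_{n-1}\cap A,\pi_n\cap E)\in\Delta$. LTL is linear temporal logic over $E\cup A$ with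 the standard semantics on infinite traces. -}

module Defs where

open import Data.Nat using (ℕ; zero; suc; _+_; _≤_; _<_)
open import Data.Fin using (Fin)
open import Data.Bool using (Bool; true; false; not; _∧_; _∨_)
open import Data.Sum using (_⊎_; inj₁; inj₂)
open import Data.Product using (Σ; ∃; _×_; _,_)
open import Relation.Binary.PropositionalEquality using (_≡_)
open import Relation.Nullary using (¬_)
open import Data.Unit using (⊤)

data BForm (V : Set) : Set where
  var  : V → BForm V
  tt   : BForm V
  ff   : BForm V
  ¬ᵇ_  : BForm V → BForm V
  _∧ᵇ_ : BForm V → BForm V → BForm V
  _∨ᵇ_ : BForm V → BForm V → BForm V

evalB : {V : Set} → BForm V → (V → Bool) → Bool
evalB (var v)   σ = σ v
evalB tt        σ = true
evalB ff        σ = false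
evalB (¬ᵇ f)    σ = not (evalB f σ)
evalB (f ∧ᵇ g)  σ = evalB f σ ∧ evalB g σ
evalB (f ∨ᵇ g)  σ = evalB f σ ∨ evalB g σ

sizeB : {V : Set} → BForm V → ℕ
sizeB (var v)  = 1
sizeB tt       = 1
sizeB ff       = 1
sizeB (¬ᵇ f)   = suc (sizeB f)
sizeB (f ∧ᵇ g) = suc (sizeB f + sizeB g)
sizeB (f ∨ᵇ g) = suc (sizeB f + sizeB g)

-- Domains, given compactly.  E = Fin n (fluents), A = Fin m (actions),
-- disjoint by construction; E' is a fresh copy of Fin n.

Var : ℕ → ℕ → Set
Var n m = Fin n ⊎ Fin m

Var' : ℕ → ℕ → Set
Var' n m = (Fin n ⊎ Fin m) ⊎ Fin n

State : ℕ → Set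
State n = Fin n → Bool

Action : ℕ → Set
Action m = Fin m → Bool

record Domain (n m : ℕ) : Set where
  field
    init : BForm (Fin n)
    pre  : BForm (Var n m)
    δ    : BForm (Var' n m)
open Domain public

sizeD : {n m : ℕ} → Domain n m → ℕ
sizeD {n} {m} D = n + m + sizeB (init D) + sizeB (pre D) + sizeB (δ D)

join : {n m : ℕ} → State n → Action m → Var n m → Bool
join s a (inj₁ e) = s e
join s a (inj₂ x) = a x

-- s ∪ a ∪ {e' : e ∈ t}
join' : {n m : ℕ} → State n → Action m → State n → Var' n m → Bool
join' s a t (inj₁ v) = join s a v
join' s a t (inj₂ e) = t e

Init : {n m : ℕ} → Domain n m → State n → Set
Init D s = evalB (init D) s ≡ true

Pre : {n m : ℕ} → Domain n m → State n → Action m → Set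
Pre D s a = evalB (pre D) (join s a) ≡ true

Δ : {n m : ℕ} → Domain n m → State n → Action m → State n → Set
Δ D s a t = evalB (δ D) (join' s a t) ≡ true

record IsDomain {n m : ℕ} (D : Domain n m) : Set where
  field
    E-nonempty  : 1 ≤ n
    A-nonempty  : 1 ≤ m
    I-nonempty  : ∃ λ (s : State n) → Init D s
    Pre-total   : ∀ (s : State n) → ∃ λ (a : Action m) → Pre D s a
    Δ⊆Pre       : ∀ s a t → Δ D s a t → Pre D s a

Trace : ℕ → ℕ → Set
Trace n m = ℕ → Var n m → Bool

stateAt : {n m : ℕ} → Trace n m → ℕ → State n
stateAt π i e = π i (inj₁ e)

actionAt : {n m : ℕ} → Trace n m → ℕ → Action m
actionAt π i a = π i (inj₂ a)

-- π ∈ ω_D  (condition (2) written with n = k+1, so [0,n-1] = [0,k])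
_∈ω_ : {n m : ℕ} → Trace n m → Domain n m → Set
π ∈ω D =
  Init D (stateAt π 0) ×
  (∀ (k : ℕ) →
     (∀ i → i ≤ k → Pre D (stateAt π i) (actionAt π i)) →
     Δ D (stateAt π k) (actionAt π k) (stateAt π (suc k)))

data LTL (V : Set) : Set where
  var  : V → LTL V
  tt   : LTL V
  ¬ₗ_  : LTL V → LTL V
  _∧ₗ_ : LTL V → LTL V → LTL V
  _∨ₗ_ : LTL V → LTL V → LTL V
  X_   : LTL V → LTL V
  _U_  : LTL V → LTL V → LTL V

sizeL : {V : Set} → LTL V → ℕ
sizeL (var v)  = 1
sizeL tt       = 1
sizeL (¬ₗ f)   = suc (sizeL f)
sizeL (f ∧ₗ g) = suc (sizeL f + sizeL g)
sizeL (f ∨ₗ g) = suc (sizeL f + sizeL g)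
sizeL (X f)    = suc (sizeL f)
sizeL (f U g)  = suc (sizeL f + sizeL g)

Sat : {V : Set} → (ℕ → V → Bool) → ℕ → LTL V → Set
Sat π i (var v)  = π i v ≡ true
Sat π i tt       = ⊤
Sat π i (¬ₗ f)   = ¬ Sat π i f
Sat π i (f ∧ₗ g) = Sat π i f × Sat π i g
Sat π i (f ∨ₗ g) = Sat π i f ⊎ Sat π i g
Sat π i (X f)    = Sat π (suc i) f
Sat π i (f U g)  = ∃ λ k → i ≤ k × Sat π k g × (∀ j → i ≤ j → j < k → Sat π j f)

_⊨_ : {V : Set} → (ℕ → V → Bool) → LTL V → Set
π ⊨ φ = Sat π 0 φ

module Submission where

-- A domain D is captured by the LTL formula
--
--     init ∧ ¬ (pre U (pre ∧ ¬ δ̂))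
--
-- where init and pre are read as propositional LTL formulas and δ̂ is δ with
-- every primed fluent e' replaced by X e.  The second conjunct says that no
-- position k has pre holding at all i ≤ k while δ̂ fails at k, which is
-- exactly condition (2) of ω_D.

open import Defs
open import Data.Bool using (Bool; true; false; not; T; _≟_)
open import Data.Bool.Properties using (T-≡; T-∧; T-∨)
open import Data.Fin using (Fin)
open import Data.Nat using (ℕ; zero; suc; _+_; _*_; _≤_; s≤s; z≤n)
open import Data.Nat.Properties
  using (≤-refl; <⇒≤; m≤n⇒m<n∨m≡n; n≤1+n; m≤m+n; +-mono-≤; +-monoʳ-≤;
         *-monoʳ-≤; *-suc; *-distribˡ-+; module ≤-Reasoning)
open import Data.Nat.Tactic.RingSolver using (solve-∀)
open import Data.Product using (Σ; _×_; _,_)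
open import Data.Product.Function.NonDependent.Propositional using (_×-⇔_)
open import Data.Sum using (inj₁; inj₂)
open import Data.Sum.Function.Propositional using (_⊎-⇔_)
open import Data.Unit using (tt)
open import Function.Bundles using (_⇔_; mk⇔; Equivalence)
open import Function.Construct.Composition using (_⇔-∘_)
open import Function.Construct.Identity using (⇔-id)
open import Function.Construct.Symmetry using (⇔-sym)
open import Function.Related.TypeIsomorphisms using (¬-cong-⇔)
open import Relation.Binary.PropositionalEquality using (_≡_; refl; sym)
open import Relation.Nullary using (¬_; Dec)
open import Relation.Nullary.Decidable using (decidable-stable)
import Relation.Nullary.Decidable as Dec

open Equivalence using (to; from)

-- Reading a Boolean formula as an LTL formula, substituting ρ v for each
-- variable v (false becomes ¬ true, since LTL has no constant false).
embed : {V W : Set} → (V → LTL W) → BForm V → LTL W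
embed ρ (var v)  = ρ v
embed ρ tt       = tt
embed ρ ff       = ¬ₗ tt
embed ρ (¬ᵇ f)   = ¬ₗ embed ρ f
embed ρ (f ∧ᵇ g) = embed ρ f ∧ₗ embed ρ g
embed ρ (f ∨ᵇ g) = embed ρ f ∨ₗ embed ρ g

unary-bound : ∀ {a x} → a ≤ 2 * x → suc a ≤ 2 * suc x
unary-bound {a} {x} a≤2x = begin
  suc a        ≤⟨ s≤s a≤2x ⟩
  suc (2 * x)  ≤⟨ n≤1+n _ ⟩
  2 + 2 * x    ≡⟨ sym (*-suc 2 x) ⟩
  2 * suc x    ∎
  where open ≤-Reasoning

binary-bound : ∀ {a b} x y → a ≤ 2 * x → b ≤ 2 * y → suc (a + b) ≤ 2 * suc (x + y)
binary-bound {a} {b} x y a≤2x b≤2y = unary-bound (begin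
  a + b          ≤⟨ +-mono-≤ a≤2x b≤2y ⟩
  2 * x + 2 * y  ≡⟨ sym (*-distribˡ-+ 2 x y) ⟩
  2 * (x + y)    ∎)
  where open ≤-Reasoning

-- If every substituted formula has size at most 2, embedding at most
-- doubles the size (the factor 2 pays for ff ↦ ¬ tt).
embed-size : {V W : Set} (ρ : V → LTL W) → (∀ v → sizeL (ρ v) ≤ 2) →
             (f : BForm V) → sizeL (embed ρ f) ≤ 2 * sizeB f
embed-size ρ small (var v)  = small v
embed-size ρ small tt       = s≤s z≤n
embed-size ρ small ff       = s≤s (s≤s z≤n)
embed-size ρ small (¬ᵇ f)   = unary-bound (embed-size ρ small f)
embed-size ρ small (f ∧ᵇ g) =
  binary-bound (sizeB f) (sizeB g) (embed-size ρ small f) (embed-size ρ small g)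
embed-size ρ small (f ∨ᵇ g) =
  binary-bound (sizeB f) (sizeB g) (embed-size ρ small f) (embed-size ρ small g)

¬T⇔T-not : ∀ b → (¬ T b) ⇔ T (not b)
¬T⇔T-not true  = mk⇔ (λ ¬⊤ → ¬⊤ tt) (λ ())
¬T⇔T-not false = mk⇔ (λ _ → tt) (λ _ ())

var-sound : {W : Set} (π : ℕ → W → Bool) (k : ℕ) (w : W) → Sat π k (var w) ⇔ T (π k w)
var-sound π k w = ⇔-sym T-≡

embed-sound : {V W : Set} (π : ℕ → W → Bool) (k : ℕ) (ρ : V → LTL W) (σ : V → Bool) →
              (∀ v → Sat π k (ρ v) ⇔ T (σ v)) →
              (f : BForm V) → Sat π k (embed ρ f) ⇔ T (evalB f σ)
embed-sound π k ρ σ agree = sound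
  where
    sound : ∀ f → Sat π k (embed ρ f) ⇔ T (evalB f σ)
    sound (var v)  = agree v
    sound tt       = ⇔-id _
    sound ff       = ¬T⇔T-not true
    sound (¬ᵇ f)   = ¬T⇔T-not (evalB f σ) ⇔-∘ ¬-cong-⇔ (sound f)
    sound (f ∧ᵇ g) = ⇔-sym T-∧ ⇔-∘ (sound f ×-⇔ sound g)
    sound (f ∨ᵇ g) = ⇔-sym T-∨ ⇔-∘ (sound f ⊎-⇔ sound g)

-- "Q k holds at every position k up to which P has held throughout";
-- condition (2) of ω_D has this shape.
Guarded : (ℕ → Set) → (ℕ → Set) → Set
Guarded P Q = ∀ k → (∀ i → i ≤ k → P i) → Q k

Guarded-cong : {P P′ Q Q′ : ℕ → Set} → (∀ i → P i ⇔ P′ i) → (∀ k → Q k ⇔ Q′ k) →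
               Guarded P Q ⇔ Guarded P′ Q′
Guarded-cong P⇔ Q⇔ = mk⇔
  (λ g k ps → to (Q⇔ k) (g k (λ i i≤k → from (P⇔ i) (ps i i≤k))))
  (λ g k ps → from (Q⇔ k) (g k (λ i i≤k → to (P⇔ i) (ps i i≤k))))

-- The LTL rendering of Guarded: there is no first violation, i.e. no point
-- where f has held so far, still holds, and g fails.
guard : {V : Set} → LTL V → LTL V → LTL V
guard f g = ¬ₗ (f U (f ∧ₗ (¬ₗ g)))

-- For decidable g, a trace satisfies guard f g iff Guarded holds pointwise.
-- Decidability is needed to turn "g cannot fail" into "g holds".
guard-sound : {V : Set} (π : ℕ → V → Bool) (f g : LTL V) → (∀ k → Dec (Sat π k g)) →
              π ⊨ guard f g ⇔ Guarded (λ i → Sat π i f) (λ k → Sat π k g)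
guard-sound π f g g? = mk⇔ guarded noViolation
  where
    guarded : π ⊨ guard f g → Guarded (λ i → Sat π i f) (λ k → Sat π k g)
    guarded noViol k fs = decidable-stable (g? k) λ ¬gk →
      noViol (k , z≤n , (fs k ≤-refl , ¬gk) , λ j _ j<k → fs j (<⇒≤ j<k))

    noViolation : Guarded (λ i → Sat π i f) (λ k → Sat π k g) → π ⊨ guard f g
    noViolation inv (k , _ , (fk , ¬gk) , before) = ¬gk (inv k fsUpTo)
      where
        fsUpTo : ∀ i → i ≤ k → Sat π i f
        fsUpTo i i≤k with m≤n⇒m<n∨m≡n i≤k
        ... | inj₁ i<k = before i z≤n i<k
        ... | inj₂ refl = fk

module _ {n m : ℕ} where

  -- The variable translations: fluents and actions of the current position
  -- are atoms, and a primed fluent e' refers to the next position, X e.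
  primedAsNext : Var' n m → LTL (Var n m)
  primedAsNext (inj₁ v) = var v
  primedAsNext (inj₂ e) = X var (inj₁ e)

  fluentAtom : Fin n → LTL (Var n m)
  fluentAtom e = var (inj₁ e)

  initL : Domain n m → LTL (Var n m)
  initL D = embed fluentAtom (init D)

  preL : Domain n m → LTL (Var n m)
  preL D = embed var (pre D)

  δL : Domain n m → LTL (Var n m)
  δL D = embed primedAsNext (δ D)

  domainFormula : Domain n m → LTL (Var n m)
  domainFormula D = initL D ∧ₗ guard (preL D) (δL D)

  module _ (D : Domain n m) (π : Trace n m) where

    initL-sound : ∀ k → Sat π k (initL D) ⇔ Init D (stateAt π k)
    initL-sound k =
      T-≡ ⇔-∘ embed-sound π k fluentAtom (stateAt π k) (λ e → var-sound π k (inj₁ e)) (init D)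

    preL-sound : ∀ k → Sat π k (preL D) ⇔ Pre D (stateAt π k) (actionAt π k)
    preL-sound k = T-≡ ⇔-∘ embed-sound π k var (join (stateAt π k) (actionAt π k)) agree (pre D)
      where
        agree : ∀ v → Sat π k (var v) ⇔ T (join (stateAt π k) (actionAt π k) v)
        agree (inj₁ e) = var-sound π k (inj₁ e)
        agree (inj₂ a) = var-sound π k (inj₂ a)

    δL-sound : ∀ k → Sat π k (δL D) ⇔ Δ D (stateAt π k) (actionAt π k) (stateAt π (suc k))
    δL-sound k = T-≡ ⇔-∘ embed-sound π k primedAsNext σ agree (δ D)
      where
        σ : Var' n m → Bool
        σ = join' (stateAt π k) (actionAt π k) (stateAt π (suc k))

        agree : ∀ v → Sat π k (primedAsNext v) ⇔ T (σ v)
        agree (inj₁ (inj₁ e)) = var-sound π k (inj₁ e)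
        agree (inj₁ (inj₂ a)) = var-sound π k (inj₂ a)
        agree (inj₂ e)        = var-sound π (suc k) (inj₁ e)

    domainFormula-sound : π ⊨ domainFormula D ⇔ π ∈ω D
    domainFormula-sound =
      initL-sound 0 ×-⇔ (Guarded-cong preL-sound δL-sound ⇔-∘ guard-sound π (preL D) (δL D) δL?)
      where
        δL? : ∀ k → Dec (Sat π k (δL D))
        δL? k = Dec.map (⇔-sym (δL-sound k)) (_ ≟ true)

-- Counting the nodes of domainFormula: 5 connectives plus the embedded
-- formulas, pre occurring twice.
domainFormula-nodes : ∀ a b d → suc (a + suc (suc (b + suc (b + suc d)))) ≡ 5 + (a + 2 * b + d)
domainFormula-nodes = solve-∀

-- The final linear estimate; the constant 5 is paid for by |E| ≥ 1.
linear-estimate : ∀ k i p t → 5 + (2 * i + 2 * (2 * p) + 2 * t) ≤ 5 * (suc k + i + p + t)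
linear-estimate k i p t = begin
  5 + (2 * i + 2 * (2 * p) + 2 * t)
    ≤⟨ m≤m+n _ (5 * k + 3 * i + p + 3 * t) ⟩
  5 + (2 * i + 2 * (2 * p) + 2 * t) + (5 * k + 3 * i + p + 3 * t)
    ≡⟨ regroup k i p t ⟩
  5 * (suc k + i + p + t) ∎
  where
    open ≤-Reasoning
    regroup : ∀ k i p t → 5 + (2 * i + 2 * (2 * p) + 2 * t) + (5 * k + 3 * i + p + 3 * t)
                          ≡ 5 * (suc k + i + p + t)
    regroup = solve-∀

domainFormula-size : ∀ {n m} (D : Domain (suc n) m) → sizeL (domainFormula D) ≤ 5 * sizeD D
domainFormula-size {n} {m} D = begin
  sizeL (domainFormula D)
    ≡⟨ domainFormula-nodes (sizeL (initL D)) (sizeL (preL D)) (sizeL (δL D)) ⟩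
  5 + (sizeL (initL D) + 2 * sizeL (preL D) + sizeL (δL D))
    ≤⟨ +-monoʳ-≤ 5 (+-mono-≤ (+-mono-≤ initBound (*-monoʳ-≤ 2 preBound)) δBound) ⟩
  5 + (2 * sizeB (init D) + 2 * (2 * sizeB (pre D)) + 2 * sizeB (δ D))
    ≤⟨ linear-estimate (n + m) (sizeB (init D)) (sizeB (pre D)) (sizeB (δ D)) ⟩
  5 * sizeD D ∎
  where
    open ≤-Reasoning
    initBound : sizeL (initL D) ≤ 2 * sizeB (init D)
    initBound = embed-size fluentAtom (λ _ → s≤s z≤n) (init D)

    preBound : sizeL (preL D) ≤ 2 * sizeB (pre D)
    preBound = embed-size var (λ _ → s≤s z≤n) (pre D)

    primedSmall : ∀ v → sizeL (primedAsNext {suc n} {m} v) ≤ 2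
    primedSmall (inj₁ v) = s≤s z≤n
    primedSmall (inj₂ e) = s≤s (s≤s z≤n)

    δBound : sizeL (δL D) ≤ 2 * sizeB (δ D)
    δBound = embed-size primedAsNext primedSmall (δ D)

lemma3 : Σ ℕ λ c → ∀ {n m : ℕ} (D : Domain n m) → IsDomain D →
           Σ (LTL (Var n m)) λ φ →
             (sizeL φ ≤ c * sizeD D) × (∀ (π : Trace n m) → (π ⊨ φ) ⇔ (π ∈ω D))
lemma3 = 5 , translation
  where
    translation : ∀ {n m : ℕ} (D : Domain n m) → IsDomain D →
                  Σ (LTL (Var n m)) λ φ →
                    (sizeL φ ≤ 5 * sizeD D) × (∀ (π : Trace n m) → (π ⊨ φ) ⇔ (π ∈ω D))
    translation {zero}  D isD with IsDomain.E-nonempty isD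
    ... | ()
    translation {suc n} D _ =
      domainFormula D , domainFormula-size D , domainFormula-sound D
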